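{- For every abelian group $V$ there is an isomorphism of abelian groups, functorial in $V$, $$\mathrm{Hom}((\mathcal{E}\otimes_{\mathbb{Z}}M)_\Delta,V)\cong Z^1(\Gamma_1,\mathrm{Hom}(M,V)),$$ where $\Delta$ acts diagonally on $\mathcal{E}\otimes M$ and $\Gamma_1$ acts on $\mathrm{Hom}(M,V)$ via $\Delta$.
   Context: $\Gamma_1$ is an abstract group, $M$ an abelian group with a linear left $\Gamma_1$-action whose kernel $\Gamma_2$ has finite index in $\Gamma_1$; $\Delta=\Gamma_1/\Gamma_2$. $\Gamma_1$ acts on $\mathrm{Hom}(M,V)$ by $(\gamma\varphi)(m)=\varphi(\gamma^{ -1}m)$; $Z^1$ denotes abstract $1$-cocycles. For each $c\in\Delta$ fix a coset representative $\bar c\in\Gamma_1$ with $\bar 1=1$. For $d,c\in\Delta$ let $\kappa(d,c)$ be the image of $\bar d\,\bar c\,\overline{dc}^{ -1}\in\Gamma_2$ in $\Gamma_2^{\mathrm{ab}}$ (written additively). Let $I_\Delta$ be the augmentation ideal of $\mathbb{Z}[\Delta]$. Define $\mathcal{E}=\Gamma_2^{\mathrm{ab}}\oplus I_\Delta$ as an abelian group, with the $\Delta$-action determined additively by $d*(g,0)=(\bar d g\bar d^{ -1},0)$ and $d*(0,c-1)=(\kappa(d,c),dc-d)$ for $g\in\Gamma_2^{\mathrm{ab}}$, $c,d\in\Delta$; this is a $\mathbb{Z}[\Delta]$-module fitting into $0\to\Gamma_2^{\mathrm{ab}}\to\mathcal{E}\to I_\Delta\to0$. -}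

module Defs where

open import Level using (Level; _⊔_)
open import Data.Nat using (ℕ; zero; suc)
open import Data.Fin using (Fin; zero; suc; _≟_)
open import Data.Integer as ℤ using (ℤ; +_; -[1+_])
open import Data.Product using (Σ; _×_; _,_)
open import Relation.Nullary using (¬_; yes; no)
open import Relation.Binary.PropositionalEquality as P using (_≡_)
open import Algebra.Bundles using (Group; AbelianGroup; RawGroup)
open import Algebra.Morphism.Structures using (module GroupMorphisms)
import Algebra.Properties.AbelianGroup as AGP
import Algebra.Properties.CommutativeSemigroup as CSP

sumFin : ∀ {n} → (Fin n → ℤ) → ℤ
sumFin {zero}  f = + 0
sumFin {suc n} f = f zero ℤ.+ sumFin (λ i → f (suc i))

record LinearAction {a ℓa b ℓb} (G : Group a ℓa) (M : AbelianGroup b ℓb)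
       : Set (a ⊔ ℓa ⊔ b ⊔ ℓb) where
  private
    module G = Group G
    module M = AbelianGroup M
  field
    act      : G.Carrier → M.Carrier → M.Carrier
    act-cong : ∀ {g g' m m'} → g G.≈ g' → m M.≈ m' → act g m M.≈ act g' m'
    act-ε    : ∀ m → act G.ε m M.≈ m
    act-∙    : ∀ g h m → act (g G.∙ h) m M.≈ act g (act h m)
    act-hom  : ∀ g m m' → act g (m M.∙ m') M.≈ (act g m M.∙ act g m')

InKer : ∀ {a ℓa b ℓb} {G : Group a ℓa} {M : AbelianGroup b ℓb} →
        LinearAction G M → Group.Carrier G → Set (b ⊔ ℓb)
InKer {M = M} A g = ∀ m → AbelianGroup._≈_ M (LinearAction.act A g m) m

-- Finite index of Γ₂ in Γ₁, together with the chosen coset representatives.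
-- Δ = Γ₁/Γ₂ is identified with Fin n via `cls`: two elements have the same
-- class iff they lie in the same coset of Γ₂.  `rep c` is the fixed
-- representative  c̄ , with  1̄ = 1.

record FiniteIndex {a ℓa b ℓb} {G : Group a ℓa} {M : AbelianGroup b ℓb}
       (A : LinearAction G M) : Set (a ⊔ ℓa ⊔ b ⊔ ℓb) where
  private
    module G = Group G
  field
    n         : ℕ
    cls       : G.Carrier → Fin n
    cls⇒ker   : ∀ g h → cls g ≡ cls h → InKer A (g G.⁻¹ G.∙ h)
    ker⇒cls   : ∀ g h → InKer A (g G.⁻¹ G.∙ h) → cls g ≡ cls h
    rep       : Fin n → G.Carrier
    cls-rep   : ∀ c → cls (rep c) ≡ c
    rep-one   : rep (cls G.ε) G.≈ G.ε

module Construction {a ℓa b ℓb} {G : Group a ℓa} {M : AbelianGroup b ℓb}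
       (A : LinearAction G M) (F : FiniteIndex A) where

  module G = Group G
  module M = AbelianGroup M
  open LinearAction A
  open FiniteIndex F

  Δ : Set
  Δ = Fin n

  oneΔ : Δ
  oneΔ = cls G.ε

  _·Δ_ : Δ → Δ → Δ
  d ·Δ c = cls (rep d G.∙ rep c)

  act-invʳ : ∀ g m → act g (act (g G.⁻¹) m) M.≈ m
  act-invʳ g m = M.trans (M.sym (act-∙ g (g G.⁻¹) m))
                   (M.trans (act-cong (G.inverseʳ g) M.refl) (act-ε m))

  act-invˡ : ∀ g m → act (g G.⁻¹) (act g m) M.≈ m
  act-invˡ g m = M.trans (M.sym (act-∙ (g G.⁻¹) g m))
                   (M.trans (act-cong (G.inverseˡ g) M.refl) (act-ε m))

  ker-ε : InKer A G.ε
  ker-ε = act-ε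

  ker-∙ : ∀ {g h} → InKer A g → InKer A h → InKer A (g G.∙ h)
  ker-∙ {g} {h} p q m = M.trans (act-∙ g h m) (M.trans (act-cong G.refl (q m)) (p m))

  ker-⁻¹ : ∀ {g} → InKer A g → InKer A (g G.⁻¹)
  ker-⁻¹ {g} p m = M.trans (act-cong G.refl (M.sym (p m))) (act-invˡ g m)

  ker-conj : ∀ x {g} → InKer A g → InKer A ((x G.∙ g) G.∙ x G.⁻¹)
  ker-conj x {g} p m =
    M.trans (act-∙ (x G.∙ g) (x G.⁻¹) m)
      (M.trans (act-∙ x g (act (x G.⁻¹) m))
        (M.trans (act-cong G.refl (p (act (x G.⁻¹) m))) (act-invʳ x m)))

  powℕ : G.Carrier → ℕ → G.Carrier
  powℕ g zero    = G.ε
  powℕ g (suc k) = g G.∙ powℕ g k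

  pow : G.Carrier → ℤ → G.Carrier
  pow g (+ k)      = powℕ g k
  pow g -[1+ k ]   = powℕ (g G.⁻¹) (suc k)

  ker-powℕ : ∀ {g} → InKer A g → ∀ k → InKer A (powℕ g k)
  ker-powℕ p zero    = ker-ε
  ker-powℕ p (suc k) = ker-∙ p (ker-powℕ p k)

  ker-pow : ∀ {g} → InKer A g → ∀ k → InKer A (pow g k)
  ker-pow p (+ k)    = ker-powℕ p k
  ker-pow p -[1+ k ] = ker-powℕ (ker-⁻¹ p) (suc k)

  prodFin : ∀ {k} → (Fin k → G.Carrier) → G.Carrier
  prodFin {zero}  f = G.ε
  prodFin {suc k} f = f zero G.∙ prodFin (λ i → f (suc i))

  ker-prod : ∀ {k} (f : Fin k → G.Carrier) → (∀ i → InKer A (f i)) → InKer A (prodFin f)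
  ker-prod {zero}  f p = ker-ε
  ker-prod {suc k} f p = ker-∙ (p zero) (ker-prod (λ i → f (suc i)) (λ i → p (suc i)))

  κ : Δ → Δ → G.Carrier
  κ d c = (rep d G.∙ rep c) G.∙ rep (d ·Δ c) G.⁻¹

  ker-κ : ∀ d c → InKer A (κ d c)
  ker-κ d c m =
    M.trans (act-∙ x (y G.⁻¹) m)
      (M.trans (act-cong G.refl step) (act-invʳ x m))
    where
    x = rep d G.∙ rep c
    y = rep (d ·Δ c)
    pk : InKer A (x G.⁻¹ G.∙ y)
    pk = cls⇒ker x y (P.sym (cls-rep (cls x)))
    m' = act (y G.⁻¹) m
    step : act (y G.⁻¹) m M.≈ act (x G.⁻¹) m
    step = M.trans (M.sym (pk m'))
             (M.trans (act-∙ (x G.⁻¹) y m') (act-cong G.refl (act-invʳ y m)))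

  data InComm : G.Carrier → Set (a ⊔ ℓa ⊔ b ⊔ ℓb) where
    c-comm : ∀ x y → InKer A x → InKer A y →
             InComm ((x G.⁻¹ G.∙ y G.⁻¹) G.∙ (x G.∙ y))
    c-ε    : InComm G.ε
    c-∙    : ∀ {x y} → InComm x → InComm y → InComm (x G.∙ y)
    c-⁻¹   : ∀ {x} → InComm x → InComm (x G.⁻¹)
    c-≈    : ∀ {x y} → x G.≈ y → InComm x → InComm y

  -- ℰ = Γ₂^ab ⊕ I_Δ.
  -- An element (g , coef) stands for  [g] + Σ_c coef(c)·(c - 1);
  -- the elements c - 1 for c ≠ 1 form a Z-basis of I_Δ, so the
  -- coefficient at c = 1 is irrelevant.

  record ℰ : Set (a ⊔ b ⊔ ℓb) where
    constructor mkℰ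
    field
      grp  : G.Carrier
      grp∈ : InKer A grp
      coef : Δ → ℤ

  open ℰ public

  _≈ℰ_ : ℰ → ℰ → Set (a ⊔ ℓa ⊔ b ⊔ ℓb)
  e ≈ℰ e' = InComm (grp e G.⁻¹ G.∙ grp e')
          × (∀ c → ¬ (c ≡ oneΔ) → coef e c ≡ coef e' c)

  _+ℰ_ : ℰ → ℰ → ℰ
  e +ℰ e' = mkℰ (grp e G.∙ grp e') (ker-∙ (grp∈ e) (grp∈ e'))
                (λ c → coef e c ℤ.+ coef e' c)

  ifEq : Δ → Δ → ℤ → ℤ
  ifEq x y k with x ≟ y
  ... | yes _ = k
  ... | no  _ = + 0

  -- the Δ-action on ℰ:
  --  d * ([g] + Σ_c a_c (c-1))
  --    = [d̄ g d̄⁻¹] + Σ_c a_c κ(d,c) + Σ_c a_c ((dc - 1) - (d - 1))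
  _*ℰ_ : Δ → ℰ → ℰ
  d *ℰ mkℰ g p a =
    mkℰ (((rep d G.∙ g) G.∙ rep d G.⁻¹) G.∙ prodFin (λ c → pow (κ d c) (a c)))
        (ker-∙ (ker-conj (rep d) p)
               (ker-prod (λ c → pow (κ d c) (a c)) (λ c → ker-pow (ker-κ d c) (a c))))
        (λ x → sumFin (λ c → ifEq (d ·Δ c) x (a c)) ℤ.- ifEq x d (sumFin a))

  -- (ℰ ⊗_ℤ M)_Δ : formal Z-combinations of symbols e ⊗ m, modulo the
  -- abelian group laws, bilinearity, and the diagonal Δ-coinvariance
  -- relation  (d*e) ⊗ (d̄·m) = e ⊗ m.

  infixl 6 _⊕_
  data Term : Set (a ⊔ b ⊔ ℓb) where
    _⊗_ : ℰ → M.Carrier → Term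
    𝟘   : Term
    _⊕_ : Term → Term → Term
    ⊖_  : Term → Term

  infix 4 _~_
  data _~_ : Term → Term → Set (a ⊔ ℓa ⊔ b ⊔ ℓb) where
    ~refl   : ∀ {s} → s ~ s
    ~sym    : ∀ {s t} → s ~ t → t ~ s
    ~trans  : ∀ {s t u} → s ~ t → t ~ u → s ~ u
    ⊕-cong  : ∀ {s s' t t'} → s ~ s' → t ~ t' → s ⊕ t ~ s' ⊕ t'
    ⊖-cong  : ∀ {s t} → s ~ t → ⊖ s ~ ⊖ t
    ⊕-assoc : ∀ s t u → (s ⊕ t) ⊕ u ~ s ⊕ (t ⊕ u)
    ⊕-comm  : ∀ s t → s ⊕ t ~ t ⊕ s
    ⊕-idˡ   : ∀ s → 𝟘 ⊕ s ~ s
    ⊖-invˡ  : ∀ s → (⊖ s) ⊕ s ~ 𝟘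
    ⊗-cong  : ∀ {e e' m m'} → e ≈ℰ e' → m M.≈ m' → e ⊗ m ~ e' ⊗ m'
    ⊗-linˡ  : ∀ e e' m → (e +ℰ e') ⊗ m ~ e ⊗ m ⊕ e' ⊗ m
    ⊗-linʳ  : ∀ e m m' → e ⊗ (m M.∙ m') ~ e ⊗ m ⊕ e ⊗ m'
    coinv   : ∀ d e m → (d *ℰ e) ⊗ act (rep d) m ~ e ⊗ m

  module _ {v ℓv} (V : AbelianGroup v ℓv) where
    private module V = AbelianGroup V
    open CSP V.commutativeSemigroup using (interchange)

    record HomT : Set (a ⊔ ℓa ⊔ b ⊔ ℓb ⊔ v ⊔ ℓv) where
      field
        fun      : Term → V.Carrier
        fun-cong : ∀ {s t} → s ~ t → fun s V.≈ fun t
        fun-⊕    : ∀ s t → fun (s ⊕ t) V.≈ (fun s V.∙ fun t)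
    open HomT

    HomT-rawGroup : RawGroup (a ⊔ ℓa ⊔ b ⊔ ℓb ⊔ v ⊔ ℓv) (a ⊔ b ⊔ ℓb ⊔ ℓv)
    HomT-rawGroup = record
      { Carrier = HomT
      ; _≈_ = λ φ ψ → ∀ t → fun φ t V.≈ fun ψ t
      ; _∙_ = λ φ ψ → record
          { fun = λ t → fun φ t V.∙ fun ψ t
          ; fun-cong = λ r → V.∙-cong (fun-cong φ r) (fun-cong ψ r)
          ; fun-⊕ = λ s t → V.trans (V.∙-cong (fun-⊕ φ s t) (fun-⊕ ψ s t))
                                    (interchange _ _ _ _) }
      ; ε = record
          { fun = λ _ → V.ε
          ; fun-cong = λ _ → V.refl
          ; fun-⊕ = λ _ _ → V.sym (V.identityˡ V.ε) }
      ; _⁻¹ = λ φ → record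
          { fun = λ t → fun φ t V.⁻¹
          ; fun-cong = λ r → V.⁻¹-cong (fun-cong φ r)
          ; fun-⊕ = λ s t → V.trans (V.⁻¹-cong (fun-⊕ φ s t))
                                    (V.sym (AGP.⁻¹-∙-comm V _ _)) }
      }

    -- Z¹(Γ₁, Hom(M,V)) with (γφ)(m) = φ(γ⁻¹ m):
    -- f(gh) = f(g) + g·f(h), i.e. f(gh)(m) = f(g)(m) + f(h)(g⁻¹ m)

    record Z¹ : Set (a ⊔ ℓa ⊔ b ⊔ ℓb ⊔ v ⊔ ℓv) where
      field
        cfun     : G.Carrier → M.Carrier → V.Carrier
        cfun-cong : ∀ {g g' m m'} → g G.≈ g' → m M.≈ m' → cfun g m V.≈ cfun g' m'
        cfun-hom  : ∀ g m m' → cfun g (m M.∙ m') V.≈ (cfun g m V.∙ cfun g m')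
        cocycle   : ∀ g h m → cfun (g G.∙ h) m V.≈ (cfun g m V.∙ cfun h (act (g G.⁻¹) m))
    open Z¹

    Z¹-≈ : Z¹ → Z¹ → Set (a ⊔ b ⊔ ℓv)
    Z¹-≈ f f' = ∀ g m → cfun f g m V.≈ cfun f' g m

    Z¹-rawGroup : RawGroup (a ⊔ ℓa ⊔ b ⊔ ℓb ⊔ v ⊔ ℓv) (a ⊔ b ⊔ ℓv)
    Z¹-rawGroup = record
      { Carrier = Z¹
      ; _≈_ = Z¹-≈
      ; _∙_ = λ f f' → record
          { cfun = λ g m → cfun f g m V.∙ cfun f' g m
          ; cfun-cong = λ p q → V.∙-cong (cfun-cong f p q) (cfun-cong f' p q)
          ; cfun-hom = λ g m m' → V.trans (V.∙-cong (cfun-hom f g m m') (cfun-hom f' g m m'))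
                                          (interchange _ _ _ _)
          ; cocycle = λ g h m → V.trans (V.∙-cong (cocycle f g h m) (cocycle f' g h m))
                                        (interchange _ _ _ _) }
      ; ε = record
          { cfun = λ _ _ → V.ε
          ; cfun-cong = λ _ _ → V.refl
          ; cfun-hom = λ _ _ _ → V.sym (V.identityˡ V.ε)
          ; cocycle = λ _ _ _ → V.sym (V.identityˡ V.ε) }
      ; _⁻¹ = λ f → record
          { cfun = λ g m → cfun f g m V.⁻¹
          ; cfun-cong = λ p q → V.⁻¹-cong (cfun-cong f p q)
          ; cfun-hom = λ g m m' → V.trans (V.⁻¹-cong (cfun-hom f g m m'))
                                          (V.sym (AGP.⁻¹-∙-comm V _ _))
          ; cocycle = λ g h m → V.trans (V.⁻¹-cong (cocycle f g h m))
                                        (V.sym (AGP.⁻¹-∙-comm V _ _)) }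
      }

  module _ {v ℓv w ℓw} {V : AbelianGroup v ℓv} {W : AbelianGroup w ℓw} where
    private
      module V = AbelianGroup V
      module W = AbelianGroup W

    AbHom : Set (v ⊔ ℓv ⊔ w ⊔ ℓw)
    AbHom = Σ (V.Carrier → W.Carrier)
              (GroupMorphisms.IsGroupHomomorphism V.rawGroup W.rawGroup)

    postT : AbHom → HomT V → HomT W
    postT (h , ih) φ = record
      { fun = λ t → h (HomT.fun φ t)
      ; fun-cong = λ r → ⟦⟧-cong (HomT.fun-cong φ r)
      ; fun-⊕ = λ s t → W.trans (⟦⟧-cong (HomT.fun-⊕ φ s t)) (homo _ _) }
      where open GroupMorphisms.IsGroupHomomorphism ih

    postZ : AbHom → Z¹ V → Z¹ W
    postZ (h , ih) f = record
      { cfun = λ g m → h (Z¹.cfun f g m)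
      ; cfun-cong = λ p q → ⟦⟧-cong (Z¹.cfun-cong f p q)
      ; cfun-hom = λ g m m' → W.trans (⟦⟧-cong (Z¹.cfun-hom f g m m')) (homo _ _)
      ; cocycle = λ g h' m → W.trans (⟦⟧-cong (Z¹.cocycle f g h' m)) (homo _ _) }
      where open GroupMorphisms.IsGroupHomomorphism ih

-- The element s γ = [γ γ̄⁻¹] + (cls γ − 1) of ℰ is a crossed homomorphism, s (g h) = s g + cls g * s h:
-- the correction κ(d,c) in the Δ-action on ℰ is exactly what this identity needs.  Hence
-- φ ↦ (γ ↦ φ (s γ ⊗ −)) turns a homomorphism on the coinvariants into a cocycle.  Conversely a cocycle
-- f defines ([g] + Σ a_c (c − 1)) ⊗ m ↦ f g m + Σ a_c f c̄ m: f is additive on Γ₂, so it kills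
-- [Γ₂,Γ₂], and coinvariance is the cocycle identity for κ(d,c) · (dc)‾ = d̄ c̄.  The two maps are
-- inverse because [g] + Σ a_c (c − 1) = s g + Σ a_c s c̄ for g ∈ Γ₂.

module Submission where

open import Defs
open import Level using (_⊔_)
open import Data.Product using (Σ; _×_; _,_)
open import Algebra.Bundles using (Monoid; Group; AbelianGroup)
open import Algebra.Morphism.Structures using (module GroupMorphisms)

open import Data.Nat as ℕ using (zero; suc)
import Data.Nat.Properties as ℕP
open import Data.Fin using (Fin; zero; suc; _≟_)
open import Data.Fin.Properties using (suc-injective)
open import Data.Integer as ℤ using (ℤ; +_; -[1+_]; _⊖_)
import Data.Integer.Properties as ℤP
open import Data.Vec.Functional using (Vector)
open import Function using (_∘_)
open import Relation.Nullary using (yes; no)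
open import Data.Empty using (⊥-elim)
open import Relation.Binary.PropositionalEquality as ≡ using (_≡_; _≢_)
import Algebra.Definitions.RawMonoid as RawMonoidDefs
import Algebra.Properties.Group as GroupProperties
import Algebra.Properties.AbelianGroup as AbelianGroupProperties
import Algebra.Properties.CommutativeSemigroup as CommutativeSemigroupProperties
import Algebra.Properties.Monoid.Sum as MonoidSum
import Algebra.Properties.Monoid.Mult as MonoidMult
import Algebra.Properties.CommutativeMonoid.Sum as CommutativeMonoidSum
import Algebra.Properties.CommutativeMonoid.Mult as CommutativeMonoidMult
import Relation.Binary.Reasoning.Setoid as SetoidReasoning

module _ {c ℓ} (M : Monoid c ℓ) where
  open Monoid M
  open MonoidSum M using (sum; sum-cong-≋; sum-replicate-zero)

  sum-single : ∀ {n} (f : Vector Carrier n) i → (∀ j → j ≢ i → f j ≈ ε) → sum f ≈ f i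
  sum-single {suc n} f zero p =
    trans (∙-congˡ (trans (sum-cong-≋ (λ j → p (suc j) λ ())) (sum-replicate-zero n)))
          (identityʳ _)
  sum-single f (suc i) p =
    trans (∙-cong (p zero λ ())
                  (sum-single (f ∘ suc) i (λ j j≢i → p (suc j) (j≢i ∘ suc-injective))))
          (identityˡ _)

sumFin≡sum : ∀ {n} (f : Fin n → ℤ) → sumFin f ≡ MonoidSum.sum ℤP.+-0-monoid f
sumFin≡sum {zero}  f = ≡.refl
sumFin≡sum {suc n} f = ≡.cong (λ s → f zero ℤ.+ s) (sumFin≡sum (f ∘ suc))

module IntegerMultiples {v ℓv} (V : AbelianGroup v ℓv) where
  open AbelianGroup V
  open GroupProperties group using (ε⁻¹≈ε; identityʳ-unique; inverseˡ-unique)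
  open AbelianGroupProperties V using (⁻¹-∙-comm)
  open CommutativeSemigroupProperties commutativeSemigroup using (interchange)
  open RawMonoidDefs rawMonoid using () renaming (_×_ to _×ₙ_)
  open MonoidMult monoid using (×-congʳ; ×-homo-+)
  open CommutativeMonoidMult commutativeMonoid using (×-distrib-+)
  open CommutativeMonoidSum commutativeMonoid
    using (sum; sum-cong-≋; sum-replicate-zero; ∑-distrib-+; ∑-comm)
  open SetoidReasoning setoid

  infixr 7.5 _·_
  _·_ : ℤ → Carrier → Carrier
  (+ n)    · x = n ×ₙ x
  -[1+ n ] · x = (suc n ×ₙ x) ⁻¹

  ·-congʳ : ∀ k {x y} → x ≈ y → k · x ≈ k · y
  ·-congʳ (+ n)    p = ×-congʳ n p
  ·-congʳ -[1+ n ] p = ⁻¹-cong (×-congʳ (suc n) p)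

  ·-distrib-∙ : ∀ k x y → k · (x ∙ y) ≈ k · x ∙ k · y
  ·-distrib-∙ (+ n)    x y = ×-distrib-+ x y n
  ·-distrib-∙ -[1+ n ] x y = trans (⁻¹-cong (×-distrib-+ x y (suc n))) (sym (⁻¹-∙-comm _ _))

  ·-ε : ∀ k → k · ε ≈ ε
  ·-ε k = identityʳ-unique (k · ε) (k · ε)
            (sym (trans (·-congʳ k (sym (identityˡ ε))) (·-distrib-∙ k ε ε)))

  xy∙[xz]⁻¹≈yz⁻¹ : ∀ x y z → (x ∙ y) ∙ (x ∙ z) ⁻¹ ≈ y ∙ z ⁻¹
  xy∙[xz]⁻¹≈yz⁻¹ x y z = begin
    (x ∙ y) ∙ (x ∙ z) ⁻¹       ≈⟨ ∙-congˡ (⁻¹-∙-comm x z) ⟨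
    (x ∙ y) ∙ (x ⁻¹ ∙ z ⁻¹)    ≈⟨ interchange x y (x ⁻¹) (z ⁻¹) ⟩
    (x ∙ x ⁻¹) ∙ (y ∙ z ⁻¹)    ≈⟨ ∙-congʳ (inverseʳ x) ⟩
    ε ∙ (y ∙ z ⁻¹)             ≈⟨ identityˡ _ ⟩
    y ∙ z ⁻¹                   ∎

  ⊖-· : ∀ m n x → (m ⊖ n) · x ≈ m ×ₙ x ∙ (n ×ₙ x) ⁻¹
  ⊖-· m       zero    x = sym (trans (∙-congˡ ε⁻¹≈ε) (identityʳ _))
  ⊖-· zero    (suc n) x = sym (identityˡ _)
  ⊖-· (suc m) (suc n) x = begin
    (suc m ⊖ suc n) · x          ≡⟨ ≡.cong (_· x) (ℤP.[1+m]⊖[1+n]≡m⊖n m n) ⟩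
    (m ⊖ n) · x                  ≈⟨ ⊖-· m n x ⟩
    m ×ₙ x ∙ (n ×ₙ x) ⁻¹         ≈⟨ xy∙[xz]⁻¹≈yz⁻¹ x (m ×ₙ x) (n ×ₙ x) ⟨
    suc m ×ₙ x ∙ (suc n ×ₙ x) ⁻¹ ∎

  ·-homo-+ : ∀ i j x → (i ℤ.+ j) · x ≈ i · x ∙ j · x
  ·-homo-+ (+ m)    (+ n)    x = ×-homo-+ x m n
  ·-homo-+ (+ m)    -[1+ n ] x = ⊖-· m (suc n) x
  ·-homo-+ -[1+ m ] (+ n)    x = trans (⊖-· n (suc m) x) (comm _ _)
  ·-homo-+ -[1+ m ] -[1+ n ] x = begin
    (suc (suc (m ℕ.+ n)) ×ₙ x) ⁻¹
      ≡⟨ ≡.cong (λ k → (suc k ×ₙ x) ⁻¹) (ℕP.+-suc m n) ⟨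
    ((suc m ℕ.+ suc n) ×ₙ x) ⁻¹
      ≈⟨ ⁻¹-cong (×-homo-+ x (suc m) (suc n)) ⟩
    (suc m ×ₙ x ∙ suc n ×ₙ x) ⁻¹
      ≈⟨ ⁻¹-∙-comm _ _ ⟨
    (suc m ×ₙ x) ⁻¹ ∙ (suc n ×ₙ x) ⁻¹ ∎

  ·-⁻¹ : ∀ k x → k · x ⁻¹ ≈ (k · x) ⁻¹
  ·-⁻¹ k x = inverseˡ-unique _ _ (begin
    k · x ⁻¹ ∙ k · x     ≈⟨ ·-distrib-∙ k (x ⁻¹) x ⟨
    k · (x ⁻¹ ∙ x)       ≈⟨ ·-congʳ k (inverseˡ x) ⟩
    k · ε                ≈⟨ ·-ε k ⟩
    ε                    ∎)

  ·-sumFin : ∀ {n} (a : Fin n → ℤ) x → sumFin a · x ≈ sum (λ i → a i · x)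
  ·-sumFin {zero}  a x = refl
  ·-sumFin {suc n} a x = trans (·-homo-+ (a zero) _ x) (∙-congˡ (·-sumFin (a ∘ suc) x))

  additive⇒multiple : (u : ℤ → Carrier) → (∀ i j → u (i ℤ.+ j) ≈ u i ∙ u j) →
                      ∀ k → u k ≈ k · u (+ 1)
  additive⇒multiple u u-+ = go
    where
    u-0 : u (+ 0) ≈ ε
    u-0 = identityʳ-unique (u (+ 0)) (u (+ 0)) (sym (u-+ (+ 0) (+ 0)))
    u-neg : ∀ k → u (ℤ.- k) ≈ u k ⁻¹
    u-neg k = inverseˡ-unique _ _ (trans (sym (u-+ (ℤ.- k) k))
                (trans (reflexive (≡.cong u (ℤP.+-inverseˡ k))) u-0))
    go-ℕ : ∀ n → u (+ n) ≈ (+ n) · u (+ 1)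
    go-ℕ zero    = u-0
    go-ℕ (suc n) = trans (u-+ (+ 1) (+ n)) (∙-congˡ (go-ℕ n))
    go : ∀ k → u k ≈ k · u (+ 1)
    go (+ n)    = go-ℕ n
    go -[1+ n ] = trans (u-neg (+ suc n)) (⁻¹-cong (go-ℕ (suc n)))

  lincomb : ∀ {n} → (Fin n → ℤ) → (Fin n → Carrier) → Carrier
  lincomb a w = sum (λ i → a i · w i)

  lincomb-cong : ∀ {n} {a b : Fin n → ℤ} {w w' : Fin n → Carrier} →
                 (∀ i → a i ≡ b i) → (∀ i → w i ≈ w' i) → lincomb a w ≈ lincomb b w'
  lincomb-cong {b = b} a≗b w≈w' =
    sum-cong-≋ (λ i → trans (reflexive (≡.cong (_· _) (a≗b i))) (·-congʳ (b i) (w≈w' i)))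

  lincomb-+ : ∀ {n} (a b : Fin n → ℤ) w →
              lincomb (λ i → a i ℤ.+ b i) w ≈ lincomb a w ∙ lincomb b w
  lincomb-+ a b w = trans (sum-cong-≋ (λ i → ·-homo-+ (a i) (b i) (w i)))
                          (∑-distrib-+ (λ i → a i · w i) (λ i → b i · w i))

  lincomb-∙ : ∀ {n} a (w w' : Fin n → Carrier) →
              lincomb a (λ i → w i ∙ w' i) ≈ lincomb a w ∙ lincomb a w'
  lincomb-∙ a w w' = trans (sum-cong-≋ (λ i → ·-distrib-∙ (a i) (w i) (w' i)))
                           (∑-distrib-+ (λ i → a i · w i) (λ i → a i · w' i))

  lincomb-neg : ∀ {n} (a : Fin n → ℤ) w → lincomb (λ i → ℤ.- a i) w ≈ lincomb a w ⁻¹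
  lincomb-neg {n} a w = inverseˡ-unique _ _ (begin
    lincomb (λ i → ℤ.- a i) w ∙ lincomb a w   ≈⟨ lincomb-+ (λ i → ℤ.- a i) a w ⟨
    lincomb (λ i → ℤ.- a i ℤ.+ a i) w
      ≈⟨ lincomb-cong (λ i → ℤP.+-inverseˡ (a i)) (λ _ → refl) ⟩
    sum {n} (λ _ → ε)                         ≈⟨ sum-replicate-zero n ⟩
    ε                                         ∎)

  lincomb-sumFin : ∀ {m n} (b : Fin m → Fin n → ℤ) w →
                   lincomb (λ i → sumFin (λ j → b j i)) w ≈ sum (λ j → lincomb (b j) w)
  lincomb-sumFin b w =
    trans (sum-cong-≋ (λ i → ·-sumFin (λ j → b j i) (w i))) (∑-comm (λ i j → b j i · w i))

  lincomb-single : ∀ {n} (a : Fin n → ℤ) w i → (∀ j → j ≢ i → a j ≡ + 0) →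
                   lincomb a w ≈ a i · w i
  lincomb-single a w i a-off =
    sum-single monoid (λ j → a j · w j) i
               (λ j j≢i → reflexive (≡.cong (_· w j) (a-off j j≢i)))

module GroupCancellation {g ℓ} (G : Group g ℓ) where
  open Group G
  open GroupProperties G using (\\-leftDividesʳ)
  open SetoidReasoning setoid

  xy⁻¹∙yz≈xz : ∀ x y z → (x ∙ y ⁻¹) ∙ (y ∙ z) ≈ x ∙ z
  xy⁻¹∙yz≈xz x y z = trans (assoc x (y ⁻¹) (y ∙ z)) (∙-congˡ (\\-leftDividesʳ y z))

  conj-telescope : ∀ g h D E R → (g ∙ D ⁻¹) ∙ (((D ∙ (h ∙ E ⁻¹)) ∙ D ⁻¹) ∙ ((D ∙ E) ∙ R ⁻¹))
                                 ≈ (g ∙ h) ∙ R ⁻¹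
  conj-telescope g h D E R = begin
    (g ∙ D ⁻¹) ∙ (((D ∙ (h ∙ E ⁻¹)) ∙ D ⁻¹) ∙ ((D ∙ E) ∙ R ⁻¹))
      ≈⟨ ∙-congˡ (assoc _ _ _) ⟩
    (g ∙ D ⁻¹) ∙ ((D ∙ (h ∙ E ⁻¹)) ∙ (D ⁻¹ ∙ ((D ∙ E) ∙ R ⁻¹)))
      ≈⟨ ∙-congˡ (∙-congˡ (∙-congˡ (assoc D E (R ⁻¹)))) ⟩
    (g ∙ D ⁻¹) ∙ ((D ∙ (h ∙ E ⁻¹)) ∙ (D ⁻¹ ∙ (D ∙ (E ∙ R ⁻¹))))
      ≈⟨ ∙-congˡ (∙-congˡ (\\-leftDividesʳ D (E ∙ R ⁻¹))) ⟩
    (g ∙ D ⁻¹) ∙ ((D ∙ (h ∙ E ⁻¹)) ∙ (E ∙ R ⁻¹))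
      ≈⟨ ∙-congˡ (assoc _ _ _) ⟩
    (g ∙ D ⁻¹) ∙ (D ∙ ((h ∙ E ⁻¹) ∙ (E ∙ R ⁻¹)))
      ≈⟨ ∙-congˡ (∙-congˡ (xy⁻¹∙yz≈xz h E (R ⁻¹))) ⟩
    (g ∙ D ⁻¹) ∙ (D ∙ (h ∙ R ⁻¹))
      ≈⟨ xy⁻¹∙yz≈xz g D (h ∙ R ⁻¹) ⟩
    g ∙ (h ∙ R ⁻¹)
      ≈⟨ assoc g h (R ⁻¹) ⟨
    (g ∙ h) ∙ R ⁻¹ ∎

module Correspondence {a ℓa b ℓb} {Γ₁ : Group a ℓa} {M : AbelianGroup b ℓb}
       (A : LinearAction Γ₁ M) (F : FiniteIndex A) where
  open Construction A F
  open LinearAction A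
  open FiniteIndex F
  open GroupProperties Γ₁ using (ε⁻¹≈ε; \\-leftDividesˡ; //-rightDividesˡ)
  open GroupCancellation Γ₁ using (conj-telescope)

  SameAction : G.Carrier → G.Carrier → Set (b ⊔ ℓb)
  SameAction x y = ∀ m → act x m M.≈ act y m

  same-sym : ∀ {x y} → SameAction x y → SameAction y x
  same-sym p m = M.sym (p m)

  same-∙ : ∀ {x x' y y'} → SameAction x x' → SameAction y y' →
           SameAction (x G.∙ y) (x' G.∙ y')
  same-∙ {x} {x'} {y} {y'} p q m =
    M.trans (act-∙ x y m)
      (M.trans (act-cong G.refl (q m)) (M.trans (p _) (M.sym (act-∙ x' y' m))))

  same⇒ker : ∀ {x y} → SameAction x y → InKer A (x G.∙ y G.⁻¹)
  same⇒ker {x} {y} p m = M.trans (act-∙ x (y G.⁻¹) m) (M.trans (p _) (act-invʳ y m))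

  same⇒ker-\\ : ∀ {x y} → SameAction x y → InKer A (x G.⁻¹ G.∙ y)
  same⇒ker-\\ {x} {y} p m =
    M.trans (act-∙ (x G.⁻¹) y m) (M.trans (act-cong G.refl (M.sym (p m))) (act-invˡ x m))

  ker-\\⇒same : ∀ {x y} → InKer A (x G.⁻¹ G.∙ y) → SameAction x y
  ker-\\⇒same {x} {y} k m = M.sym (begin
    act y m                            ≈⟨ act-invʳ x (act y m) ⟨
    act x (act (x G.⁻¹) (act y m))     ≈⟨ act-cong G.refl (act-∙ (x G.⁻¹) y m) ⟨
    act x (act (x G.⁻¹ G.∙ y) m)       ≈⟨ act-cong G.refl (k m) ⟩
    act x m                            ∎)
    where open SetoidReasoning M.setoid

  ≡cls⇒same : ∀ {x y} → cls x ≡ cls y → SameAction x y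
  ≡cls⇒same {x} {y} p = ker-\\⇒same (cls⇒ker x y p)

  same⇒≡cls : ∀ {x y} → SameAction x y → cls x ≡ cls y
  same⇒≡cls {x} {y} p = ker⇒cls x y (same⇒ker-\\ p)

  rep-cls-same : ∀ g → SameAction (rep (cls g)) g
  rep-cls-same g = ≡cls⇒same (cls-rep (cls g))

  cls-cong : ∀ {x y} → x G.≈ y → cls x ≡ cls y
  cls-cong p = same⇒≡cls (λ m → act-cong p M.refl)

  cls-∙ : ∀ g h → cls (g G.∙ h) ≡ cls g ·Δ cls h
  cls-∙ g h = same⇒≡cls (same-∙ (same-sym (rep-cls-same g)) (same-sym (rep-cls-same h)))

  ker⇒cls≡oneΔ : ∀ {g} → InKer A g → cls g ≡ oneΔ
  ker⇒cls≡oneΔ k = same⇒≡cls (λ m → M.trans (k m) (M.sym (act-ε m)))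

  ker-≈ : ∀ {x y} → x G.≈ y → InKer A x → InKer A y
  ker-≈ p k m = M.trans (act-cong (G.sym p) M.refl) (k m)

  comm⇒ker : ∀ {x} → InComm x → InKer A x
  comm⇒ker (c-comm x y kx ky) = ker-∙ (ker-∙ (ker-⁻¹ kx) (ker-⁻¹ ky)) (ker-∙ kx ky)
  comm⇒ker c-ε                = ker-ε
  comm⇒ker (c-∙ p q)          = ker-∙ (comm⇒ker p) (comm⇒ker q)
  comm⇒ker (c-⁻¹ p)           = ker-⁻¹ (comm⇒ker p)
  comm⇒ker (c-≈ x≈y p)        = ker-≈ x≈y (comm⇒ker p)

  ifEq-refl : ∀ x k → ifEq x x k ≡ k
  ifEq-refl x k with x ≟ x
  ... | yes _  = ≡.refl
  ... | no x≢x = ⊥-elim (x≢x ≡.refl)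

  ifEq-≢ : ∀ {x y} k → x ≢ y → ifEq x y k ≡ + 0
  ifEq-≢ {x} {y} k x≢y with x ≟ y
  ... | yes x≡y = ⊥-elim (x≢y x≡y)
  ... | no _    = ≡.refl

  ifEq-sym : ∀ x y k → ifEq x y k ≡ ifEq y x k
  ifEq-sym x y k with x ≟ y
  ... | yes ≡.refl = ≡.sym (ifEq-refl x k)
  ... | no x≢y     = ≡.sym (ifEq-≢ k (x≢y ∘ ≡.sym))

  ifEq-+ : ∀ x y i j → ifEq x y (i ℤ.+ j) ≡ ifEq x y i ℤ.+ ifEq x y j
  ifEq-+ x y i j with x ≟ y
  ... | yes _ = ≡.refl
  ... | no _  = ≡.refl

  ifEq-0 : ∀ x y → ifEq x y (+ 0) ≡ + 0
  ifEq-0 x y with x ≟ y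
  ... | yes _ = ≡.refl
  ... | no _  = ≡.refl

  sumFin-single : ∀ (a : Δ → ℤ) i → (∀ j → j ≢ i → a j ≡ + 0) → sumFin a ≡ a i
  sumFin-single a i a-off = ≡.trans (sumFin≡sum a) (sum-single ℤP.+-0-monoid a i a-off)

  sumFin-ifEq : ∀ (a : Δ → ℤ) x → sumFin (λ c → ifEq c x (a c)) ≡ a x
  sumFin-ifEq a x =
    ≡.trans (sumFin-single _ x (λ c c≢x → ifEq-≢ (a c) c≢x)) (ifEq-refl x (a x))

  ≈ℰ-intro : ∀ {e e'} → grp e G.≈ grp e' → (∀ c → coef e c ≡ coef e' c) → e ≈ℰ e'
  ≈ℰ-intro {e} p q = c-≈ (G.sym (G.trans (G.∙-congˡ (G.sym p)) (G.inverseˡ (grp e)))) c-ε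
                   , λ c _ → q c

  ≈ℰ-refl : ∀ e → e ≈ℰ e
  ≈ℰ-refl e = ≈ℰ-intro {e} {e} G.refl (λ _ → ≡.refl)

  prodFin≈sum : ∀ {k} (f : Fin k → G.Carrier) → prodFin f G.≈ MonoidSum.sum G.monoid f
  prodFin≈sum {zero}  f = G.refl
  prodFin≈sum {suc k} f = G.∙-congˡ (prodFin≈sum (f ∘ suc))

  cocycleℰ : G.Carrier → ℰ
  cocycleℰ g = mkℰ (g G.∙ rep (cls g) G.⁻¹) (same⇒ker (same-sym (rep-cls-same g)))
                   (λ x → ifEq (cls g) x (+ 1))

  cocycleℰ-cong : ∀ {g g'} → g G.≈ g' → cocycleℰ g ≈ℰ cocycleℰ g'
  cocycleℰ-cong {g} {g'} p = ≈ℰ-intro {cocycleℰ g} {cocycleℰ g'}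
    (G.∙-cong p (G.⁻¹-cong (G.reflexive (≡.cong rep (cls-cong p)))))
    (λ c → ≡.cong (λ z → ifEq z c (+ 1)) (cls-cong p))

  cocycleℰ-∙ : ∀ g h → cocycleℰ (g G.∙ h) ≈ℰ (cocycleℰ g +ℰ (cls g *ℰ cocycleℰ h))
  cocycleℰ-∙ g h = ≈ℰ-intro {cocycleℰ (g G.∙ h)} {cocycleℰ g +ℰ (cls g *ℰ cocycleℰ h)}
                             (G.sym grp-eq) (λ x → ≡.sym (coef-eq x))
    where
    d = cls g
    e = cls h
    D = rep d
    E = rep e
    δe : Δ → ℤ
    δe c = ifEq e c (+ 1)
    δe-off : ∀ c → c ≢ e → δe c ≡ + 0
    δe-off c c≢e = ifEq-≢ (+ 1) (c≢e ∘ ≡.sym)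

    κ-prod : prodFin (λ c → pow (κ d c) (δe c)) G.≈ κ d e
    κ-prod = G.trans (prodFin≈sum (λ c → pow (κ d c) (δe c)))
               (G.trans (sum-single G.monoid (λ c → pow (κ d c) (δe c)) e
                          (λ c c≢e → G.reflexive (≡.cong (pow (κ d c)) (δe-off c c≢e))))
                        (G.trans (G.reflexive (≡.cong (pow (κ d e)) (ifEq-refl e (+ 1))))
                                 (G.identityʳ (κ d e))))

    grp-eq : grp (cocycleℰ g +ℰ (d *ℰ cocycleℰ h)) G.≈ grp (cocycleℰ (g G.∙ h))
    grp-eq = G.trans (G.∙-congˡ (G.∙-congˡ κ-prod))
               (G.trans (conj-telescope g h D E (rep (d ·Δ e)))
                        (G.∙-congˡ (G.⁻¹-cong (G.reflexive (≡.cong rep (≡.sym (cls-∙ g h)))))))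

    δe-sum : sumFin δe ≡ + 1
    δe-sum = ≡.trans (sumFin-single δe e δe-off) (ifEq-refl e (+ 1))

    shifted-sum : ∀ x → sumFin (λ c → ifEq (d ·Δ c) x (δe c)) ≡ ifEq (d ·Δ e) x (+ 1)
    shifted-sum x = ≡.trans
      (sumFin-single _ e (λ c c≢e → ≡.trans (≡.cong (ifEq (d ·Δ c) x) (δe-off c c≢e))
                                            (ifEq-0 (d ·Δ c) x)))
      (≡.cong (ifEq (d ·Δ e) x) (ifEq-refl e (+ 1)))

    coef-eq : ∀ x → coef (cocycleℰ g +ℰ (d *ℰ cocycleℰ h)) x ≡ coef (cocycleℰ (g G.∙ h)) x
    coef-eq x = begin
      ifEq d x (+ 1) ℤ.+ (sumFin (λ c → ifEq (d ·Δ c) x (δe c)) ℤ.- ifEq x d (sumFin δe))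
        ≡⟨ ≡.cong₂ (λ u w → ifEq d x (+ 1) ℤ.+ (u ℤ.- w)) (shifted-sum x)
                   (≡.trans (≡.cong (ifEq x d) δe-sum) (ifEq-sym x d (+ 1))) ⟩
      ifEq d x (+ 1) ℤ.+ (ifEq (d ·Δ e) x (+ 1) ℤ.- ifEq d x (+ 1))
        ≡⟨ ≡.sym (ℤP.+-assoc (ifEq d x (+ 1)) _ _) ⟩
      ifEq d x (+ 1) ℤ.+ ifEq (d ·Δ e) x (+ 1) ℤ.- ifEq d x (+ 1)
        ≡⟨ ℤ-xyx⁻¹≈y (ifEq d x (+ 1)) _ ⟩
      ifEq (d ·Δ e) x (+ 1)
        ≡⟨ ≡.cong (λ z → ifEq z x (+ 1)) (cls-∙ g h) ⟨
      ifEq (cls (g G.∙ h)) x (+ 1) ∎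
      where
      open ≡.≡-Reasoning
      open AbelianGroupProperties ℤP.+-0-abelianGroup renaming (xyx⁻¹≈y to ℤ-xyx⁻¹≈y)

  module CocycleProperties {v ℓv} {V : AbelianGroup v ℓv} (f : Z¹ V) where
    private module V = AbelianGroup V
    open Z¹ f
    open GroupProperties V.group
      using (identityʳ-unique; inverseˡ-unique; ∙-cancelʳ) renaming (ε⁻¹≈ε to V-ε⁻¹≈ε)
    open IntegerMultiples V using (_·_; ·-⁻¹; ·-congʳ)
    open CommutativeMonoidSum V.commutativeMonoid using (sum)
    open SetoidReasoning V.setoid

    cfun-ε : ∀ m → cfun G.ε m V.≈ V.ε
    cfun-ε m = identityʳ-unique (cfun G.ε m) (cfun G.ε m) (begin
      cfun G.ε m V.∙ cfun G.ε m
        ≈⟨ V.∙-congˡ (cfun-cong G.refl (M.trans (act-cong ε⁻¹≈ε M.refl) (act-ε m))) ⟨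
      cfun G.ε m V.∙ cfun G.ε (act (G.ε G.⁻¹) m)  ≈⟨ cocycle G.ε G.ε m ⟨
      cfun (G.ε G.∙ G.ε) m                        ≈⟨ cfun-cong (G.identityˡ G.ε) M.refl ⟩
      cfun G.ε m                                  ∎)

    cfun-ker-∙ : ∀ {g} → InKer A g → ∀ h m → cfun (g G.∙ h) m V.≈ cfun g m V.∙ cfun h m
    cfun-ker-∙ {g} k h m = V.trans (cocycle g h m) (V.∙-congˡ (cfun-cong G.refl (ker-⁻¹ k m)))

    cfun-ker-⁻¹ : ∀ {g} → InKer A g → ∀ m → cfun (g G.⁻¹) m V.≈ cfun g m V.⁻¹
    cfun-ker-⁻¹ {g} k m = inverseˡ-unique _ _ (begin
      cfun (g G.⁻¹) m V.∙ cfun g m  ≈⟨ cfun-ker-∙ (ker-⁻¹ k) g m ⟨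
      cfun (g G.⁻¹ G.∙ g) m         ≈⟨ cfun-cong (G.inverseˡ g) M.refl ⟩
      cfun G.ε m                    ≈⟨ cfun-ε m ⟩
      V.ε                           ∎)

    cfun-comm : ∀ {x} → InComm x → ∀ m → cfun x m V.≈ V.ε
    cfun-comm (c-comm x y kx ky) m = begin
      cfun ((x G.⁻¹ G.∙ y G.⁻¹) G.∙ (x G.∙ y)) m
        ≈⟨ cfun-ker-∙ (ker-∙ (ker-⁻¹ kx) (ker-⁻¹ ky)) _ m ⟩
      cfun (x G.⁻¹ G.∙ y G.⁻¹) m V.∙ cfun (x G.∙ y) m
        ≈⟨ V.∙-cong (V.trans (cfun-ker-∙ (ker-⁻¹ kx) _ m)
                             (V.∙-cong (cfun-ker-⁻¹ kx m) (cfun-ker-⁻¹ ky m)))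
                    (cfun-ker-∙ kx y m) ⟩
      (cfun x m V.⁻¹ V.∙ cfun y m V.⁻¹) V.∙ (cfun x m V.∙ cfun y m)
        ≈⟨ V.∙-congʳ (⁻¹-∙-comm _ _) ⟩
      (cfun x m V.∙ cfun y m) V.⁻¹ V.∙ (cfun x m V.∙ cfun y m)
        ≈⟨ V.inverseˡ _ ⟩
      V.ε ∎
      where open AbelianGroupProperties V using (⁻¹-∙-comm)
    cfun-comm c-ε m = cfun-ε m
    cfun-comm (c-∙ {x} {y} p q) m =
      V.trans (cfun-ker-∙ (comm⇒ker p) y m)
              (V.trans (V.∙-cong (cfun-comm p m) (cfun-comm q m)) (V.identityˡ V.ε))
    cfun-comm (c-⁻¹ p) m =
      V.trans (cfun-ker-⁻¹ (comm⇒ker p) m) (V.trans (V.⁻¹-cong (cfun-comm p m)) V-ε⁻¹≈ε)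
    cfun-comm (c-≈ x≈y p) m = V.trans (cfun-cong (G.sym x≈y) M.refl) (cfun-comm p m)

    cfun-powℕ : ∀ {y} → InKer A y → ∀ n m → cfun (powℕ y n) m V.≈ (+ n) · cfun y m
    cfun-powℕ k zero    m = cfun-ε m
    cfun-powℕ k (suc n) m = V.trans (cfun-ker-∙ k _ m) (V.∙-congˡ (cfun-powℕ k n m))

    cfun-pow : ∀ {y} → InKer A y → ∀ k m → cfun (pow y k) m V.≈ k · cfun y m
    cfun-pow ky (+ n)    m = cfun-powℕ ky n m
    cfun-pow ky -[1+ n ] m = begin
      cfun (powℕ (_ G.⁻¹) (suc n)) m    ≈⟨ cfun-powℕ (ker-⁻¹ ky) (suc n) m ⟩
      (+ suc n) · cfun (_ G.⁻¹) m       ≈⟨ ·-congʳ (+ suc n) (cfun-ker-⁻¹ ky m) ⟩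
      (+ suc n) · cfun _ m V.⁻¹         ≈⟨ ·-⁻¹ (+ suc n) _ ⟩
      -[1+ n ] · cfun _ m               ∎

    cfun-prodFin : ∀ {k} (h : Fin k → G.Carrier) → (∀ i → InKer A (h i)) →
                   ∀ m → cfun (prodFin h) m V.≈ sum (λ i → cfun (h i) m)
    cfun-prodFin {zero}  h kh m = cfun-ε m
    cfun-prodFin {suc k} h kh m =
      V.trans (cfun-ker-∙ (kh zero) _ m) (V.∙-congˡ (cfun-prodFin (h ∘ suc) (kh ∘ suc) m))

    cfun-ker-factor : ∀ {k} y x z → InKer A k → k G.∙ y G.≈ x G.∙ z → ∀ m →
                      cfun k (act x m) V.∙ cfun y (act x m) V.≈ cfun x (act x m) V.∙ cfun z m
    cfun-ker-factor {k} y x z kk ky≈xz m = begin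
      cfun k (act x m) V.∙ cfun y (act x m)                ≈⟨ cfun-ker-∙ kk y (act x m) ⟨
      cfun (k G.∙ y) (act x m)                             ≈⟨ cfun-cong ky≈xz M.refl ⟩
      cfun (x G.∙ z) (act x m)                             ≈⟨ cocycle x z (act x m) ⟩
      cfun x (act x m) V.∙ cfun z (act (x G.⁻¹) (act x m))
        ≈⟨ V.∙-congˡ (cfun-cong G.refl (act-invˡ x m)) ⟩
      cfun x (act x m) V.∙ cfun z m                        ∎

    cfun-conj : ∀ {g} → InKer A g → ∀ x m →
                cfun ((x G.∙ g) G.∙ x G.⁻¹) (act x m) V.≈ cfun g m
    cfun-conj {g} kg x m = ∙-cancelʳ (cfun x (act x m)) _ _ (V.trans
      (cfun-ker-factor x x g (ker-conj x kg) (//-rightDividesˡ x (x G.∙ g)) m)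
      (V.comm _ _))

  inj-I : (Δ → ℤ) → ℰ
  inj-I a = mkℰ G.ε ker-ε a

  inj-I-δ≈cocycleℰ : ∀ c → inj-I (λ x → ifEq c x (+ 1)) ≈ℰ cocycleℰ (rep c)
  inj-I-δ≈cocycleℰ c = ≈ℰ-intro {inj-I _} {cocycleℰ (rep c)}
    (G.sym (G.trans (G.∙-congˡ (G.⁻¹-cong (G.reflexive (≡.cong rep (cls-rep c)))))
                    (G.inverseʳ (rep c))))
    (λ x → ≡.cong (λ z → ifEq z x (+ 1)) (≡.sym (cls-rep c)))

  ker≈cocycleℰ+inj-I : ∀ g (kg : InKer A g) a → mkℰ g kg a ≈ℰ (cocycleℰ g +ℰ inj-I a)
  ker≈cocycleℰ+inj-I g kg a = c-≈ (G.sym (G.trans (G.∙-congˡ grp-eq) (G.inverseˡ g))) c-ε , coef-eq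
    where
    cls-g : cls g ≡ oneΔ
    cls-g = ker⇒cls≡oneΔ kg
    grp-eq : (g G.∙ rep (cls g) G.⁻¹) G.∙ G.ε G.≈ g
    grp-eq = G.trans (G.identityʳ _) (G.trans (G.∙-congˡ ḡ⁻¹≈ε) (G.identityʳ g))
      where
      ḡ⁻¹≈ε : rep (cls g) G.⁻¹ G.≈ G.ε
      ḡ⁻¹≈ε = G.trans (G.⁻¹-cong (G.trans (G.reflexive (≡.cong rep cls-g)) rep-one)) ε⁻¹≈ε
    coef-eq : ∀ c → c ≢ oneΔ → a c ≡ ifEq (cls g) c (+ 1) ℤ.+ a c
    coef-eq c c≢oneΔ = ≡.sym (≡.trans
      (≡.cong (ℤ._+ a c) (ifEq-≢ (+ 1) (λ clsg≡c → c≢oneΔ (≡.trans (≡.sym clsg≡c) cls-g))))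
      (ℤP.+-identityˡ (a c)))

  module _ {v ℓv} (V : AbelianGroup v ℓv) where
    private module V = AbelianGroup V

    toCocycle : HomT V → Z¹ V
    toCocycle φ = record
      { cfun      = λ g m → fun (cocycleℰ g ⊗ m)
      ; cfun-cong = λ g≈g' m≈m' → fun-cong (⊗-cong (cocycleℰ-cong g≈g') m≈m')
      ; cfun-hom  = λ g m m' → V.trans (fun-cong (⊗-linʳ _ m m')) (fun-⊕ _ _)
      ; cocycle   = cocycle-identity
      }
      where
      open HomT φ
      open SetoidReasoning V.setoid
      cocycle-identity : ∀ g h m → fun (cocycleℰ (g G.∙ h) ⊗ m) V.≈
                                   fun (cocycleℰ g ⊗ m) V.∙ fun (cocycleℰ h ⊗ act (g G.⁻¹) m)
      cocycle-identity g h m = begin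
        fun (cocycleℰ (g G.∙ h) ⊗ m)
          ≈⟨ fun-cong (⊗-cong (cocycleℰ-∙ g h) M.refl) ⟩
        fun ((cocycleℰ g +ℰ (d *ℰ cocycleℰ h)) ⊗ m)
          ≈⟨ fun-cong (⊗-linˡ _ _ m) ⟩
        fun (cocycleℰ g ⊗ m ⊕ (d *ℰ cocycleℰ h) ⊗ m)
          ≈⟨ fun-⊕ _ _ ⟩
        fun (cocycleℰ g ⊗ m) V.∙ fun ((d *ℰ cocycleℰ h) ⊗ m)
          ≈⟨ V.∙-congˡ (fun-cong coinvariance) ⟩
        fun (cocycleℰ g ⊗ m) V.∙ fun (cocycleℰ h ⊗ act (g G.⁻¹) m) ∎
        where
        d = cls g
        m≈d̄g⁻¹m : m M.≈ act (rep d) (act (g G.⁻¹) m)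
        m≈d̄g⁻¹m = M.sym (M.trans (rep-cls-same g _) (act-invʳ g m))
        coinvariance : (d *ℰ cocycleℰ h) ⊗ m ~ cocycleℰ h ⊗ act (g G.⁻¹) m
        coinvariance =
          ~trans (⊗-cong (≈ℰ-refl (d *ℰ cocycleℰ h)) m≈d̄g⁻¹m) (coinv d (cocycleℰ h) _)

  module FromCocycle {v ℓv} {V : AbelianGroup v ℓv} (f : Z¹ V) where
    open AbelianGroup V
    open Z¹ f
    open CocycleProperties f
    open IntegerMultiples V
    open CommutativeMonoidSum commutativeMonoid using (sum; sum-cong-≋; ∑-distrib-+)
    open CommutativeSemigroupProperties commutativeSemigroup using (interchange)
    open AbelianGroupProperties V using (xyx⁻¹≈y)
    open SetoidReasoning setoid

    ⟦_⊗_⟧ : ℰ → M.Carrier → Carrier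
    ⟦ e ⊗ m ⟧ = cfun (grp e) m ∙ lincomb (coef e) (λ c → cfun (rep c) m)

    ⟦⊗⟧-cong : ∀ {e e' m m'} → e ≈ℰ e' → m M.≈ m' → ⟦ e ⊗ m ⟧ ≈ ⟦ e' ⊗ m' ⟧
    ⟦⊗⟧-cong {e} {e'} {m} {m'} (comm-grp , coef-off) m≈m' = ∙-cong grp-part (sum-cong-≋ coef-part)
      where
      grp-part : cfun (grp e) m ≈ cfun (grp e') m'
      grp-part = sym (begin
        cfun (grp e') m'
          ≈⟨ cfun-cong G.refl (M.sym m≈m') ⟩
        cfun (grp e') m
          ≈⟨ cfun-cong (\\-leftDividesˡ (grp e) (grp e')) M.refl ⟨
        cfun (grp e G.∙ (grp e G.⁻¹ G.∙ grp e')) m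
          ≈⟨ cfun-ker-∙ (grp∈ e) _ m ⟩
        cfun (grp e) m ∙ cfun (grp e G.⁻¹ G.∙ grp e') m
          ≈⟨ ∙-congˡ (cfun-comm comm-grp m) ⟩
        cfun (grp e) m ∙ ε
          ≈⟨ identityʳ _ ⟩
        cfun (grp e) m ∎)
      rep-oneΔ-vanishes : ∀ k m → k · cfun (rep oneΔ) m ≈ ε
      rep-oneΔ-vanishes k m = trans (·-congʳ k (trans (cfun-cong rep-one M.refl) (cfun-ε m))) (·-ε k)
      coef-part : ∀ c → coef e c · cfun (rep c) m ≈ coef e' c · cfun (rep c) m'
      coef-part c with c ≟ oneΔ
      ... | yes ≡.refl = trans (rep-oneΔ-vanishes (coef e c) m) (sym (rep-oneΔ-vanishes (coef e' c) m'))
      ... | no c≢oneΔ  = trans (reflexive (≡.cong (_· _) (coef-off c c≢oneΔ)))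
                               (·-congʳ (coef e' c) (cfun-cong G.refl m≈m'))

    ⟦⊗⟧-+ℰ : ∀ e e' m → ⟦ (e +ℰ e') ⊗ m ⟧ ≈ ⟦ e ⊗ m ⟧ ∙ ⟦ e' ⊗ m ⟧
    ⟦⊗⟧-+ℰ e e' m =
      trans (∙-cong (cfun-ker-∙ (grp∈ e) (grp e') m) (lincomb-+ (coef e) (coef e') _))
            (interchange _ _ _ _)

    ⟦⊗⟧-∙ : ∀ e m m' → ⟦ e ⊗ (m M.∙ m') ⟧ ≈ ⟦ e ⊗ m ⟧ ∙ ⟦ e ⊗ m' ⟧
    ⟦⊗⟧-∙ e m m' = trans
      (∙-cong (cfun-hom (grp e) m m')
              (trans (lincomb-cong {a = coef e} (λ _ → ≡.refl) (λ c → cfun-hom (rep c) m m'))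
                     (lincomb-∙ (coef e) (λ c → cfun (rep c) m) (λ c → cfun (rep c) m'))))
      (interchange _ _ _ _)

    ⟦⊗⟧-coinv : ∀ d e m → ⟦ (d *ℰ e) ⊗ act (rep d) m ⟧ ≈ ⟦ e ⊗ m ⟧
    ⟦⊗⟧-coinv d (mkℰ g kg a) m = begin
      ⟦ (d *ℰ mkℰ g kg a) ⊗ D·m ⟧         ≈⟨ ∙-cong grp-part coef-part ⟩
      (cfun g m ∙ K) ∙ (S₃ ∙ S₁ ⁻¹)       ≈⟨ assoc _ _ _ ⟩
      cfun g m ∙ (K ∙ (S₃ ∙ S₁ ⁻¹))       ≈⟨ ∙-congˡ (assoc _ _ _) ⟨
      cfun g m ∙ ((K ∙ S₃) ∙ S₁ ⁻¹)       ≈⟨ ∙-congˡ (∙-congʳ κ-part) ⟩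
      cfun g m ∙ ((S₁ ∙ S₂) ∙ S₁ ⁻¹)      ≈⟨ ∙-congˡ (xyx⁻¹≈y S₁ S₂) ⟩
      cfun g m ∙ S₂                       ∎
      where
      D = rep d
      D·m = act D m
      w : Δ → Carrier
      w x = cfun (rep x) D·m
      K  = sum (λ c → a c · cfun (κ d c) D·m)
      S₁ = sum (λ c → a c · cfun D D·m)
      S₂ = lincomb a (λ c → cfun (rep c) m)
      S₃ = sum (λ c → a c · w (d ·Δ c))

      grp-part : cfun (grp (d *ℰ mkℰ g kg a)) D·m ≈ cfun g m ∙ K
      grp-part = trans (cfun-ker-∙ (ker-conj D kg) _ D·m)
        (∙-cong (cfun-conj kg D m)
                (trans (cfun-prodFin _ (λ c → ker-pow (ker-κ d c) (a c)) D·m)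
                       (sum-cong-≋ (λ c → cfun-pow (ker-κ d c) (a c) D·m))))

      shifted-part : lincomb (λ x → sumFin (λ c → ifEq (d ·Δ c) x (a c))) w ≈ S₃
      shifted-part = trans (lincomb-sumFin (λ c x → ifEq (d ·Δ c) x (a c)) w)
        (sum-cong-≋ (λ c → trans
          (lincomb-single _ w (d ·Δ c) (λ x x≢dc → ifEq-≢ (a c) (x≢dc ∘ ≡.sym)))
          (reflexive (≡.cong (_· w (d ·Δ c)) (ifEq-refl (d ·Δ c) (a c))))))

      total-part : lincomb (λ x → ifEq x d (sumFin a)) w ≈ S₁
      total-part = begin
        lincomb (λ x → ifEq x d (sumFin a)) w  ≈⟨ lincomb-single _ w d (λ x → ifEq-≢ (sumFin a)) ⟩
        ifEq d d (sumFin a) · w d              ≡⟨ ≡.cong (_· w d) (ifEq-refl d (sumFin a)) ⟩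
        sumFin a · w d                         ≈⟨ ·-sumFin a (w d) ⟩
        S₁                                     ∎

      coef-part : lincomb (coef (d *ℰ mkℰ g kg a)) w ≈ S₃ ∙ S₁ ⁻¹
      coef-part = trans (lincomb-+ (λ x → sumFin (λ c → ifEq (d ·Δ c) x (a c)))
                                   (λ x → ℤ.- ifEq x d (sumFin a)) w)
                        (∙-cong shifted-part
                                (trans (lincomb-neg (λ x → ifEq x d (sumFin a)) w) (⁻¹-cong total-part)))

      κ-factor : ∀ c → cfun (κ d c) D·m ∙ w (d ·Δ c) ≈ cfun D D·m ∙ cfun (rep c) m
      κ-factor c = cfun-ker-factor (rep (d ·Δ c)) D (rep c) (ker-κ d c)
                                   (//-rightDividesˡ (rep (d ·Δ c)) (D G.∙ rep c)) m

      κ-part : K ∙ S₃ ≈ S₁ ∙ S₂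
      κ-part = begin
        K ∙ S₃
          ≈⟨ ∑-distrib-+ _ (λ c → a c · w (d ·Δ c)) ⟨
        sum (λ c → a c · cfun (κ d c) D·m ∙ a c · w (d ·Δ c))
          ≈⟨ sum-cong-≋ (λ c → ·-distrib-∙ (a c) _ _) ⟨
        sum (λ c → a c · (cfun (κ d c) D·m ∙ w (d ·Δ c)))
          ≈⟨ sum-cong-≋ (λ c → ·-congʳ (a c) (κ-factor c)) ⟩
        sum (λ c → a c · (cfun D D·m ∙ cfun (rep c) m))
          ≈⟨ sum-cong-≋ (λ c → ·-distrib-∙ (a c) _ _) ⟩
        sum (λ c → a c · cfun D D·m ∙ a c · cfun (rep c) m)
          ≈⟨ ∑-distrib-+ (λ c → a c · cfun D D·m) _ ⟩
        S₁ ∙ S₂ ∎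

    evalTerm : Term → Carrier
    evalTerm (e ⊗ m) = ⟦ e ⊗ m ⟧
    evalTerm 𝟘       = ε
    evalTerm (s ⊕ t) = evalTerm s ∙ evalTerm t
    evalTerm (⊖ s)   = evalTerm s ⁻¹

    evalTerm-cong : ∀ {s t} → s ~ t → evalTerm s ≈ evalTerm t
    evalTerm-cong ~refl                           = refl
    evalTerm-cong (~sym r)                        = sym (evalTerm-cong r)
    evalTerm-cong (~trans r r')                   = trans (evalTerm-cong r) (evalTerm-cong r')
    evalTerm-cong (⊕-cong r r')                   = ∙-cong (evalTerm-cong r) (evalTerm-cong r')
    evalTerm-cong (⊖-cong r)                      = ⁻¹-cong (evalTerm-cong r)
    evalTerm-cong (⊕-assoc s t u)                 = assoc _ _ _
    evalTerm-cong (⊕-comm s t)                    = comm _ _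
    evalTerm-cong (⊕-idˡ s)                       = identityˡ _
    evalTerm-cong (⊖-invˡ s)                      = inverseˡ _
    evalTerm-cong (⊗-cong {e} {e'} e≈e' m≈m')     = ⟦⊗⟧-cong {e} {e'} e≈e' m≈m'
    evalTerm-cong (⊗-linˡ e e' m)                 = ⟦⊗⟧-+ℰ e e' m
    evalTerm-cong (⊗-linʳ e m m')                 = ⟦⊗⟧-∙ e m m'
    evalTerm-cong (coinv d e m)                   = ⟦⊗⟧-coinv d e m

    fromCocycle : HomT V
    fromCocycle = record { fun = evalTerm ; fun-cong = evalTerm-cong ; fun-⊕ = λ _ _ → refl }

    ⟦cocycleℰ⊗⟧ : ∀ g m → ⟦ cocycleℰ g ⊗ m ⟧ ≈ cfun g m
    ⟦cocycleℰ⊗⟧ g m = begin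
      cfun (g G.∙ C G.⁻¹) m ∙ lincomb (λ x → ifEq (cls g) x (+ 1)) (λ x → cfun (rep x) m)
        ≈⟨ ∙-congˡ (lincomb-single _ _ (cls g) (λ x x≢c → ifEq-≢ (+ 1) (x≢c ∘ ≡.sym))) ⟩
      cfun (g G.∙ C G.⁻¹) m ∙ ifEq (cls g) (cls g) (+ 1) · cfun C m
        ≡⟨ ≡.cong (λ k → cfun (g G.∙ C G.⁻¹) m ∙ k · cfun C m) (ifEq-refl (cls g) (+ 1)) ⟩
      cfun (g G.∙ C G.⁻¹) m ∙ (cfun C m ∙ ε)   ≈⟨ ∙-congˡ (identityʳ _) ⟩
      cfun (g G.∙ C G.⁻¹) m ∙ cfun C m         ≈⟨ cfun-ker-∙ (grp∈ (cocycleℰ g)) C m ⟨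
      cfun ((g G.∙ C G.⁻¹) G.∙ C) m            ≈⟨ cfun-cong (//-rightDividesˡ C g) M.refl ⟩
      cfun g m                                 ∎
      where C = rep (cls g)

  module _ {v ℓv} (V : AbelianGroup v ℓv) where
    open AbelianGroup V
    open HomT
    open GroupProperties group using (identityʳ-unique; inverseˡ-unique)
    open IntegerMultiples V using (_·_; ·-congʳ; additive⇒multiple; lincomb; lincomb-cong)
    open CommutativeMonoidSum commutativeMonoid using (sum; sum-cong-≋)
    open SetoidReasoning setoid

    fun-𝟘 : (φ : HomT V) → fun φ 𝟘 ≈ ε
    fun-𝟘 φ = identityʳ-unique _ _ (trans (sym (fun-⊕ φ 𝟘 𝟘)) (fun-cong φ (⊕-idˡ 𝟘)))

    fun-⊖ : (φ : HomT V) → ∀ t → fun φ (⊖ t) ≈ fun φ t ⁻¹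
    fun-⊖ φ t = inverseˡ-unique _ _
      (trans (sym (fun-⊕ φ (⊖ t) t)) (trans (fun-cong φ (⊖-invˡ t)) (fun-𝟘 φ)))

    HomT-ext : (φ ψ : HomT V) → (∀ e m → fun φ (e ⊗ m) ≈ fun ψ (e ⊗ m)) →
               ∀ t → fun φ t ≈ fun ψ t
    HomT-ext φ ψ p (e ⊗ m) = p e m
    HomT-ext φ ψ p 𝟘       = trans (fun-𝟘 φ) (sym (fun-𝟘 ψ))
    HomT-ext φ ψ p (s ⊕ t) = trans (fun-⊕ φ s t)
      (trans (∙-cong (HomT-ext φ ψ p s) (HomT-ext φ ψ p t)) (sym (fun-⊕ ψ s t)))
    HomT-ext φ ψ p (⊖ t)   = trans (fun-⊖ φ t)
      (trans (⁻¹-cong (HomT-ext φ ψ p t)) (sym (fun-⊖ ψ t)))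

    module Reconstruction (φ : HomT V) where
      open FromCocycle (toCocycle V φ) using (⟦_⊗_⟧)

      φI : (Δ → ℤ) → M.Carrier → Carrier
      φI a m = fun φ (inj-I a ⊗ m)

      φI-+ : ∀ a b m → φI (λ x → a x ℤ.+ b x) m ≈ φI a m ∙ φI b m
      φI-+ a b m = trans (fun-cong φ (~trans (⊗-cong I-+ M.refl) (⊗-linˡ (inj-I a) (inj-I b) m)))
                         (fun-⊕ φ _ _)
        where
        I-+ : inj-I (λ x → a x ℤ.+ b x) ≈ℰ (inj-I a +ℰ inj-I b)
        I-+ = ≈ℰ-intro {inj-I _} {inj-I a +ℰ inj-I b} (G.sym (G.identityˡ G.ε)) (λ _ → ≡.refl)

      φI-cong : ∀ {a b} m → (∀ x → a x ≡ b x) → φI a m ≈ φI b m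
      φI-cong {a} {b} m a≗b = fun-cong φ (⊗-cong (≈ℰ-intro {inj-I a} {inj-I b} G.refl a≗b) M.refl)

      φI-sumFin : ∀ {k} (b : Fin k → Δ → ℤ) m →
                  φI (λ x → sumFin (λ c → b c x)) m ≈ sum (λ c → φI (b c) m)
      φI-sumFin {zero}  b m = identityʳ-unique _ _ (sym (φI-+ (λ _ → + 0) (λ _ → + 0) m))
      φI-sumFin {suc k} b m = trans (φI-+ (b zero) _ m) (∙-congˡ (φI-sumFin (b ∘ suc) m))

      φI-δ : ∀ c k m → φI (λ x → ifEq c x k) m ≈ k · fun φ (cocycleℰ (rep c) ⊗ m)
      φI-δ c k m = trans
        (additive⇒multiple (λ j → φI (λ x → ifEq c x j) m)
                           (λ i j → trans (φI-cong m (λ x → ifEq-+ c x i j)) (φI-+ _ _ m)) k)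
        (·-congʳ k (fun-cong φ (⊗-cong (inj-I-δ≈cocycleℰ c) M.refl)))

      φI≈lincomb : ∀ a m → φI a m ≈ lincomb a (λ c → fun φ (cocycleℰ (rep c) ⊗ m))
      φI≈lincomb a m = begin
        φI a m                                       ≈⟨ φI-cong m (λ x → ≡.sym (sumFin-ifEq a x)) ⟩
        φI (λ x → sumFin (λ c → ifEq c x (a c))) m   ≈⟨ φI-sumFin (λ c x → ifEq c x (a c)) m ⟩
        sum (λ c → φI (λ x → ifEq c x (a c)) m)      ≈⟨ sum-cong-≋ (λ c → φI-δ c (a c) m) ⟩
        lincomb a (λ c → fun φ (cocycleℰ (rep c) ⊗ m)) ∎

      reconstruct : ∀ e m → fun φ (e ⊗ m) ≈ ⟦ e ⊗ m ⟧
      reconstruct (mkℰ g kg a) m = begin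
        fun φ (mkℰ g kg a ⊗ m)
          ≈⟨ fun-cong φ (⊗-cong (ker≈cocycleℰ+inj-I g kg a) M.refl) ⟩
        fun φ ((cocycleℰ g +ℰ inj-I a) ⊗ m)
          ≈⟨ fun-cong φ (⊗-linˡ _ _ m) ⟩
        fun φ (cocycleℰ g ⊗ m ⊕ inj-I a ⊗ m)
          ≈⟨ fun-⊕ φ _ _ ⟩
        fun φ (cocycleℰ g ⊗ m) ∙ φI a m
          ≈⟨ ∙-congˡ (φI≈lincomb a m) ⟩
        ⟦ mkℰ g kg a ⊗ m ⟧ ∎

    toCocycle-injective : ∀ φ ψ → Z¹-≈ V (toCocycle V φ) (toCocycle V ψ) →
                          ∀ t → fun φ t ≈ fun ψ t
    toCocycle-injective φ ψ Φφ≈Φψ = HomT-ext φ ψ λ e m → begin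
      fun φ (e ⊗ m)                                         ≈⟨ Reconstruction.reconstruct φ e m ⟩
      FromCocycle.⟦_⊗_⟧ (toCocycle V φ) e m
        ≈⟨ ∙-cong (Φφ≈Φψ _ m)
                  (lincomb-cong {a = coef e} (λ _ → ≡.refl) (λ c → Φφ≈Φψ (rep c) m)) ⟩
      FromCocycle.⟦_⊗_⟧ (toCocycle V ψ) e m                 ≈⟨ Reconstruction.reconstruct ψ e m ⟨
      fun ψ (e ⊗ m)                                         ∎

    toCocycle-surjective : ∀ f (φ : HomT V) → (∀ t → fun φ t ≈ FromCocycle.evalTerm f t) →
                           Z¹-≈ V (toCocycle V φ) f
    toCocycle-surjective f φ φ≈Ψf g m =
      trans (φ≈Ψf (cocycleℰ g ⊗ m)) (FromCocycle.⟦cocycleℰ⊗⟧ f g m)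

    toCocycle-isGroupIsomorphism :
      GroupMorphisms.IsGroupIsomorphism (HomT-rawGroup V) (Z¹-rawGroup V) (toCocycle V)
    toCocycle-isGroupIsomorphism = record
      { isGroupMonomorphism = record
        { isGroupHomomorphism = record
          { isMonoidHomomorphism = record
            { isMagmaHomomorphism = record
              { isRelHomomorphism = record { cong = λ φ≈ψ g m → φ≈ψ (cocycleℰ g ⊗ m) }
              ; homo = λ _ _ _ _ → refl }
            ; ε-homo = λ _ _ → refl }
          ; ⁻¹-homo = λ _ _ _ → refl }
        ; injective = λ {φ} {ψ} → toCocycle-injective φ ψ }
      ; surjective = λ f → FromCocycle.fromCocycle f , λ {φ} → toCocycle-surjective f φ }

proposition4p5 : ∀ {a ℓa b ℓb v ℓv} {Γ₁ : Group a ℓa} {M : AbelianGroup b ℓb}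
    (A : LinearAction Γ₁ M) (F : FiniteIndex A) →
    let open Construction A F in
    Σ ((V : AbelianGroup v ℓv) → HomT V → Z¹ V) λ Φ →
    (∀ V → GroupMorphisms.IsGroupIsomorphism (HomT-rawGroup V) (Z¹-rawGroup V) (Φ V))
    × (∀ V W (h : AbHom {V = V} {W = W}) (φ : HomT V) →
    Z¹-≈ W (Φ W (postT h φ)) (postZ h (Φ V φ)))
proposition4p5 A F =
  toCocycle , toCocycle-isGroupIsomorphism , λ V W h φ g m → AbelianGroup.refl W
  where open Correspondence A F
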